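{- Let $k \ge 1$ and let $\widehat{C}_{4k+1}$ denote the hatted cycle obtained from the cycle $C_{4k+1}$ by adding one new vertex and joining it to two vertices that are at distance $2$ on the cycle. Then $\gamma_g(\widehat{C}_{4k+1}) = 2k+1 = \frac{n(\widehat{C}_{4k+1})}{2}$.
   Context: The domination game on a graph $G$ is played by Dominator and Staller, who alternately select vertices of $G$; each selected vertex must dominate (i.e., be equal or adjacent to) at least one vertex not dominated by the previously selected vertices. The game ends when no such move is possible (the selected vertices then form a dominating set). Dominator wants to minimize the number of moves, Staller to maximize it. $\gamma_g(G)$ (the game domination number) is the number of moves when both play optimally and Dominator makes the first move. $n(G)$ denotes the number of vertices of $G$. -}

module Defs where

open import Data.Nat using (ℕ; zero; suc; _+_; _*_; _∸_; _<_; _≤_; s≤s; z≤n)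
open import Data.Nat.Properties using (1+n≢n; +-monoˡ-≤; *-monoʳ-≤; <⇒≢; ≤-trans; ∸-monoˡ-≤)
open import Data.Fin using (Fin; toℕ)
open import Data.List using (List; []; _∷_)
open import Data.List.Membership.Propositional using (_∈_)
open import Data.Product using (Σ; ∃; _×_; _,_)
open import Data.Sum using (_⊎_; inj₁; inj₂)
open import Data.Empty using (⊥)
open import Relation.Nullary using (¬_)
open import Relation.Binary.PropositionalEquality using (_≡_; refl) renaming (sym to ≡-sym)

record Graph : Set₁ where
  field
    n     : ℕ
    Adj   : Fin n → Fin n → Set
    sym   : ∀ {u v} → Adj u v → Adj v u
    irrefl : ∀ {u} → ¬ Adj u u

open Graph public

module Game (G : Graph) where
  V : Set
  V = Fin (n G)

  Dom : V → V → Set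
  Dom v u = (v ≡ u) ⊎ Adj G v u

  -- a position is the list of vertices selected so far
  Dominated : List V → V → Set
  Dominated S u = Σ V λ v → (v ∈ S) × Dom v u

  AllDominated : List V → Set
  AllDominated S = ∀ u → Dominated S u

  Legal : List V → V → Set
  Legal S v = Σ V λ u → Dom v u × ¬ Dominated S u

  mutual
    -- Dominator (minimiser) can guarantee that at most m further moves are
    -- played, Dominator to move / Staller to move.
    data MinD : ℕ → List V → Set where
      doneD : ∀ {m S} → AllDominated S → MinD m S
      moveD : ∀ {m S} v → Legal S v → MinS m (v ∷ S) → MinD (suc m) S

    data MinS : ℕ → List V → Set where
      doneS : ∀ {m S} → AllDominated S → MinS m S
      moveS : ∀ {m S} → (∀ v → Legal S v → MinD m (v ∷ S)) → MinS (suc m) S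

  mutual
    -- Staller (maximiser) can guarantee that at least m further moves are
    -- played, Staller to move / Dominator to move.
    data MaxS : ℕ → List V → Set where
      zeroS : ∀ {S} → MaxS zero S
      moveS : ∀ {m S} v → Legal S v → MaxD m (v ∷ S) → MaxS (suc m) S

    data MaxD : ℕ → List V → Set where
      zeroD : ∀ {S} → MaxD zero S
      moveD : ∀ {m S} → (Σ V λ v → Legal S v) →
              (∀ v → Legal S v → MaxS m (v ∷ S)) → MaxD (suc m) S

  -- γ_g(G) = m : under optimal play (Dominator starting) exactly m moves
  -- are made, i.e. Dominator can force ≤ m and Staller can force ≥ m.
  GameDominationNumberIs : ℕ → Set
  GameDominationNumberIs m = MinD m [] × MaxD m []

-- The hatted cycle \hat C_{4k+1}: cycle vertices 0,…,4k (4k+1 of them),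
-- plus a hat vertex 4k+1 adjacent to cycle vertices 0 and 2.

-- adjacency on the underlying naturals, N = 4k+1 = number of cycle vertices
hatAdjℕ : ℕ → ℕ → ℕ → Set
hatAdjℕ N i j =
    (i < N × j < N × (j ≡ suc i ⊎ i ≡ suc j ⊎ (i ≡ 0 × j ≡ N ∸ 1) ⊎ (j ≡ 0 × i ≡ N ∸ 1)))
  ⊎ (i ≡ N × (j ≡ 0 ⊎ j ≡ 2))
  ⊎ (j ≡ N × (i ≡ 0 ⊎ i ≡ 2))

hatAdjℕ-sym : ∀ N {i j} → hatAdjℕ N i j → hatAdjℕ N j i
hatAdjℕ-sym N (inj₁ (i<N , j<N , inj₁ e)) = inj₁ (j<N , i<N , inj₂ (inj₁ e))
hatAdjℕ-sym N (inj₁ (i<N , j<N , inj₂ (inj₁ e))) = inj₁ (j<N , i<N , inj₁ e)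
hatAdjℕ-sym N (inj₁ (i<N , j<N , inj₂ (inj₂ (inj₁ e)))) = inj₁ (j<N , i<N , inj₂ (inj₂ (inj₂ e)))
hatAdjℕ-sym N (inj₁ (i<N , j<N , inj₂ (inj₂ (inj₂ e)))) = inj₁ (j<N , i<N , inj₂ (inj₂ (inj₁ e)))
hatAdjℕ-sym N (inj₂ (inj₁ p)) = inj₂ (inj₂ p)
hatAdjℕ-sym N (inj₂ (inj₂ p)) = inj₂ (inj₁ p)

private
  five≤ : ∀ k → 1 ≤ k → 5 ≤ 4 * k + 1
  five≤ k k≥1 = +-monoˡ-≤ 1 (*-monoʳ-≤ 4 k≥1)

  not0 : ∀ k → 1 ≤ k → ¬ 0 ≡ 4 * k + 1 ∸ 1
  not0 k k≥1 e = <⇒≢ (≤-trans (s≤s z≤n) (∸-monoˡ-≤ 1 (five≤ k k≥1))) e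

  notHat : ∀ k → 1 ≤ k → ∀ {i} → i ≡ 4 * k + 1 → ¬ (i ≡ 0 ⊎ i ≡ 2)
  notHat k k≥1 refl (inj₁ e) = <⇒≢ (≤-trans (s≤s z≤n) (five≤ k k≥1)) (≡-sym e)
  notHat k k≥1 refl (inj₂ e) = <⇒≢ (≤-trans (s≤s (s≤s (s≤s z≤n))) (five≤ k k≥1)) (≡-sym e)

hatAdjℕ-irrefl : ∀ k → 1 ≤ k → ∀ {i} → ¬ hatAdjℕ (4 * k + 1) i i
hatAdjℕ-irrefl k k≥1 (inj₁ (_ , _ , inj₁ e)) = 1+n≢n (≡-sym e)
hatAdjℕ-irrefl k k≥1 (inj₁ (_ , _ , inj₂ (inj₁ e))) = 1+n≢n (≡-sym e)
hatAdjℕ-irrefl k k≥1 (inj₁ (_ , _ , inj₂ (inj₂ (inj₁ (refl , e))))) = not0 k k≥1 e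
hatAdjℕ-irrefl k k≥1 (inj₁ (_ , _ , inj₂ (inj₂ (inj₂ (refl , e))))) = not0 k k≥1 e
hatAdjℕ-irrefl k k≥1 (inj₂ (inj₁ (e , f))) = notHat k k≥1 e f
hatAdjℕ-irrefl k k≥1 (inj₂ (inj₂ (e , f))) = notHat k k≥1 e f

hatC : (k : ℕ) → 1 ≤ k → Graph
hatC k k≥1 = record
  { n      = 4 * k + 2
  ; Adj    = λ u v → hatAdjℕ (4 * k + 1) (toℕ u) (toℕ v)
  ; sym    = hatAdjℕ-sym (4 * k + 1)
  ; irrefl = hatAdjℕ-irrefl k k≥1
  }

module Submission where

-- Both bounds are potential arguments.
--
-- Upper bound: Dominator opens at cycle vertex 0, which dominates 0, 1, the last
-- cycle vertex and the hat, so only the inner path 2, …, 4k-1 stays undominated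
-- ("white").  The potential Φ = (white path vertices) + 2·(runs of them) starts at 4k,
-- drops by at least 1 under every move, and by at least 3 when Dominator plays the
-- successor of the first vertex of a run; so at most 2k more moves are made.
--
-- Lower bound: a vertex dominates at most three cycle vertices, and Staller can always
-- play a vertex newly dominating only one (next to a dominated/white boundary of the
-- cycle, or vertex 1 once the hat was played).  Each round thus removes at most 4 of
-- the 4k+1 white cycle vertices, and at least 2k+1 moves are made.

open import Defs hiding (sym)
open import Data.Nat using (ℕ; zero; suc; pred; _+_; _*_; _∸_; _≤_; _<_; z≤n; s≤s; _≟_; _≤?_; _<?_; _≤ᵇ_)
open import Data.Nat.Properties
open import Data.Bool using (Bool; true; false; _∧_; _∨_; not; T)
open import Data.Bool.Properties using (T-∧; ∧-zeroʳ; ∧-identityʳ; ∨-zeroʳ)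
open import Data.Unit using (tt)
open import Data.Fin using (toℕ; fromℕ<)
open import Data.Fin.Properties using (toℕ-fromℕ<; toℕ-injective; toℕ<n; all?; ¬∀⟶∃¬)
open import Data.List using (List; []; _∷_)
open import Data.List.Relation.Unary.Any using (here; there; any?)
open import Data.List.Membership.Propositional using (_∈_; find; lose)
open import Data.Product using (Σ; _×_; _,_; proj₁; proj₂)
open import Data.Sum using (_⊎_; inj₁; inj₂; map₂)
open import Data.Empty using (⊥-elim)
open import Function.Bundles using (Equivalence)
open import Relation.Nullary using (¬_; Dec; yes; no; does)
open import Relation.Nullary.Decidable using (map′; dec-true; dec-false)
open import Relation.Nullary.Decidable.Core using (_×-dec_; _⊎-dec_)
open import Relation.Binary.PropositionalEquality
open import Relation.Binary.Definitions using (tri<; tri≈; tri>)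
open import Data.Nat.Tactic.RingSolver using (solve-∀)

sumRange : (ℕ → ℕ) → ℕ → ℕ → ℕ
sumRange f a zero = 0
sumRange f a (suc n) = f a + sumRange f (suc a) n

InRange : ℕ → ℕ → ℕ → Set
InRange a n i = a ≤ i × i < a + n

private
  inRange-tail : ∀ {a n i} → InRange (suc a) n i → InRange a (suc n) i
  inRange-tail {a} {n} {i} (p , q) = <⇒≤ p , subst (i <_) (sym (+-suc a n)) q

  inRange-head : ∀ a n → InRange a (suc n) a
  inRange-head a n = ≤-refl , m<m+n a (s≤s z≤n)

sumRange-mono : ∀ f g a n → (∀ i → InRange a n i → f i ≤ g i) → sumRange f a n ≤ sumRange g a n
sumRange-mono f g a zero h = z≤n
sumRange-mono f g a (suc n) h =
  +-mono-≤ (h a (inRange-head a n)) (sumRange-mono f g (suc a) n (λ i r → h i (inRange-tail r)))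

sumRange-cong : ∀ f g a n → (∀ i → InRange a n i → f i ≡ g i) → sumRange f a n ≡ sumRange g a n
sumRange-cong f g a n h =
  ≤-antisym (sumRange-mono f g a n (λ i r → ≤-reflexive (h i r)))
            (sumRange-mono g f a n (λ i r → ≤-reflexive (sym (h i r))))

sumRange-+ : ∀ f g a n → sumRange (λ i → f i + g i) a n ≡ sumRange f a n + sumRange g a n
sumRange-+ f g a zero = refl
sumRange-+ f g a (suc n) =
  trans (cong (f a + g a +_) (sumRange-+ f g (suc a) n)) (interchange (f a) (g a) _ _)
  where
  interchange : ∀ a b c d → (a + b) + (c + d) ≡ (a + c) + (b + d)
  interchange = solve-∀

sumRange-split : ∀ f a m n → sumRange f a (m + n) ≡ sumRange f a m + sumRange f (a + m) n
sumRange-split f a zero n = cong (λ x → sumRange f x n) (sym (+-identityʳ a))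
sumRange-split f a (suc m) n =
  trans (cong (f a +_) (trans (sumRange-split f (suc a) m n)
          (cong (λ x → sumRange f (suc a) m + sumRange f x n) (sym (+-suc a m)))))
        (sym (+-assoc (f a) _ _))

sumRange-const : ∀ f a n c → (∀ i → InRange a n i → f i ≡ c) → sumRange f a n ≡ n * c
sumRange-const f a zero c h = refl
sumRange-const f a (suc n) c h =
  cong₂ _+_ (h a (inRange-head a n)) (sumRange-const f (suc a) n c (λ i r → h i (inRange-tail r)))

windowSum : (ℕ → ℕ) → ℕ → ℕ
windowSum f c = f c + (f (suc c) + (f (suc (suc c)) + f (suc (suc (suc c)))))

sumRange-window : ∀ f c r → sumRange f 0 (c + (4 + r)) ≡ sumRange f 0 c + (windowSum f c + sumRange f (4 + c) r)
sumRange-window f c r = trans (sumRange-split f 0 c (4 + r))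
  (cong (sumRange f 0 c +_) (reassoc (f c) (f (suc c)) (f (suc (suc c))) (f (suc (suc (suc c)))) _))
  where
  reassoc : ∀ a b c d e → a + (b + (c + (d + e))) ≡ (a + (b + (c + d))) + e
  reassoc = solve-∀

bit : Bool → ℕ
bit true = 1
bit false = 0

count-witness : ∀ (g : ℕ → Bool) a n → 1 ≤ sumRange (λ i → bit (g i)) a n →
  Σ ℕ λ i → InRange a n i × g i ≡ true
count-witness g a zero ()
count-witness g a (suc n) h with g a in eq
... | true = a , inRange-head a n , eq
... | false with count-witness g (suc a) n h
...   | i , r , gi = i , inRange-tail r , gi

point : ℕ → ℕ → ℕ → ℕ
point p c i with i ≟ p
... | yes _ = c
... | no _ = 0

point-hit : ∀ {p} c i → i ≡ p → c ≤ point p c i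
point-hit {p} c .p refl with p ≟ p
... | yes _ = ≤-refl
... | no ne = ⊥-elim (ne refl)

sumRange-point : ∀ p c a n → sumRange (point p c) a n ≤ c
sumRange-point p c a n = go a n
  where
  vanishes : ∀ a n → p < a → sumRange (point p c) a n ≡ 0
  vanishes a zero _ = refl
  vanishes a (suc n) p<a with a ≟ p
  ... | yes refl = ⊥-elim (<-irrefl refl p<a)
  ... | no _ = vanishes (suc a) n (≤-trans p<a (n≤1+n a))
  go : ∀ a n → sumRange (point p c) a n ≤ c
  go a zero = z≤n
  go a (suc n) with a ≟ p
  ... | yes refl = ≤-reflexive (trans (cong (c +_) (vanishes (suc a) n ≤-refl)) (+-identityʳ c))
  ... | no _ = go (suc a) n

switch : ∀ (f : ℕ → Bool) a n → f a ≡ false → f (a + n) ≡ true →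
         Σ ℕ λ i → InRange a n i × f i ≡ false × f (suc i) ≡ true
switch f a zero fa fan with trans (sym fa) (subst (λ x → f x ≡ true) (+-identityʳ a) fan)
... | ()
switch f a (suc n) fa fan with f (suc a) in eq
... | true = a , inRange-head a n , fa , eq
... | false with switch f (suc a) n eq (subst (λ x → f x ≡ true) (+-suc a n) fan)
...   | i , r , fi , fs = i , inRange-tail r , fi , fs

-- Identities between Boolean functions of five variables, checked by evaluation.
∀ᵇ : (Bool → Bool) → Bool
∀ᵇ p = p false ∧ p true

∀ᵇ-sound : ∀ p → T (∀ᵇ p) → ∀ x → T (p x)
∀ᵇ-sound p t false = proj₁ (Equivalence.to T-∧ t)
∀ᵇ-sound p t true = proj₂ (Equivalence.to T-∧ t)

∀ᵇ⁵-sound : ∀ (p : Bool → Bool → Bool → Bool → Bool → Bool) →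
  T (∀ᵇ λ a → ∀ᵇ λ b → ∀ᵇ λ c → ∀ᵇ λ d → ∀ᵇ λ e → p a b c d e) →
  ∀ a b c d e → T (p a b c d e)
∀ᵇ⁵-sound p t a b c d e =
  ∀ᵇ-sound (p a b c d) (∀ᵇ-sound (λ d → ∀ᵇ (p a b c d))
    (∀ᵇ-sound (λ c → ∀ᵇ λ d → ∀ᵇ (p a b c d))
    (∀ᵇ-sound (λ b → ∀ᵇ λ c → ∀ᵇ λ d → ∀ᵇ (p a b c d))
      (∀ᵇ-sound (λ a → ∀ᵇ λ b → ∀ᵇ λ c → ∀ᵇ λ d → ∀ᵇ (p a b c d)) t a) b) c) d) e

T-⇒ : ∀ x y → T (not x ∨ y) → x ≡ true → T y
T-⇒ .true y t refl = t

does-sound : ∀ {A : Set} (a? : Dec A) → does a? ≡ true → A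
does-sound (yes a) _ = a

-- Potential-function strategies, valid on every graph.

module Strategies (G : Graph) where
  open Game G

  dominated? : (∀ v u → Dec (Dom v u)) → ∀ S u → Dec (Dominated S u)
  dominated? dom? S u = map′ find (λ (v , v∈S , d) → lose v∈S d) (any? (λ v → dom? v u) S)

  gameStatus : (∀ v u → Dec (Dom v u)) → ∀ S → AllDominated S ⊎ Σ V λ u → ¬ Dominated S u
  gameStatus dom? S with all? (dominated? dom? S)
  ... | yes all = inj₁ all
  ... | no ¬all = inj₂ (¬∀⟶∃¬ _ (Dominated S) (dominated? dom? S) ¬all)

  -- Suppose a potential Φ, on
  -- positions satisfying an invariant preserved by all moves, drops by at least 1
  -- under every move and Dominator can always make it drop by at least 3.  Then a
  -- position of potential ≤ 2m with Staller to move (≤ 2m+1 with Dominator to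
  -- move) lasts at most m more moves.
  module DominatorPotential
    (status : ∀ S → AllDominated S ⊎ Σ V λ u → ¬ Dominated S u)
    (Inv : List V → Set) (Φ : List V → ℕ)
    (inv-step : ∀ {S} v → Inv S → Inv (v ∷ S))
    (any-drop : ∀ {S v} → Inv S → Legal S v → Φ (v ∷ S) + 1 ≤ Φ S)
    (good-drop : ∀ {S u} → Inv S → ¬ Dominated S u → Σ V λ v → Legal S v × Φ (v ∷ S) + 3 ≤ Φ S)
    where

    positive : ∀ {S u} → Inv S → ¬ Dominated S u → 3 ≤ Φ S
    positive inv ¬d with good-drop inv ¬d
    ... | _ , _ , drop = ≤-trans (m≤n+m 3 _) drop

    private
      cancel-drop : ∀ {x z} d → x + d ≤ z + d → x ≤ z
      cancel-drop {x} {z} d = +-cancelʳ-≤ d x z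

    mutual
      stallerTurn : ∀ m {S} → Inv S → Φ S ≤ m + m → MinS m S
      stallerTurn m {S} inv Φ≤ with status S
      ... | inj₁ done = doneS done
      stallerTurn zero inv Φ≤ | inj₂ (u , ¬d) = ⊥-elim (<⇒≱ (s≤s z≤n) (≤-trans (positive inv ¬d) Φ≤))
      stallerTurn (suc m) inv Φ≤ | inj₂ _ = moveS λ v legal →
        dominatorTurn m (inv-step v inv)
          (cancel-drop 1 (≤-trans (any-drop inv legal) (≤-trans Φ≤ (≤-reflexive (two-rounds m)))))
        where
        two-rounds : ∀ m → suc m + suc m ≡ suc (m + m) + 1
        two-rounds = solve-∀

      dominatorTurn : ∀ m {S} → Inv S → Φ S ≤ suc (m + m) → MinD m S
      dominatorTurn m {S} inv Φ≤ with status S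
      ... | inj₁ done = doneD done
      dominatorTurn zero inv Φ≤ | inj₂ (u , ¬d) =
        ⊥-elim (<⇒≱ (s≤s (s≤s z≤n)) (≤-trans (positive inv ¬d) Φ≤))
      dominatorTurn (suc m) inv Φ≤ | inj₂ (u , ¬d) with good-drop inv ¬d
      ... | v , legal , drop =
        moveD v legal (stallerTurn m (inv-step v inv)
          (cancel-drop 3 (≤-trans drop (≤-trans Φ≤ (≤-reflexive (two-rounds m))))))
        where
        two-rounds : ∀ m → suc (suc m + suc m) ≡ m + m + 3
        two-rounds = solve-∀

  -- Suppose a quantity Ψ drops by at
  -- most 3 under any move, some move is legal while Ψ > 0, and (once a move has been
  -- played) Staller can always make Ψ drop by at most 1 while Ψ > 0.  Then from a
  -- position with Ψ ≥ 4j+1 and Dominator to move, Staller forces at least 2j+1 moves.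
  module StallerPotential
    (Ψ : List V → ℕ)
    (available : ∀ {S} → 1 ≤ Ψ S → Σ V (Legal S))
    (any-drop : ∀ S v → Ψ S ≤ Ψ (v ∷ S) + 3)
    (slow-drop : ∀ {v S} → 1 ≤ Ψ (v ∷ S) →
                 Σ V λ x → Legal (v ∷ S) x × Ψ (v ∷ S) ≤ Ψ (x ∷ v ∷ S) + 1)
    where

    private
      -- one round (a Dominator move and a cheap Staller reply) costs at most 4
      round-bound : ∀ j {a b c} → suc (4 * suc j) ≤ a → a ≤ b + 3 → b ≤ c + 1 → suc (4 * j) ≤ c
      round-bound j {a} {b} {c} Ψ≥ dom stal =
        +-cancelʳ-≤ 4 (suc (4 * j)) c
          (subst₂ _≤_ (budget j) (+-assoc c 1 3) (≤-trans Ψ≥ (≤-trans dom (+-monoˡ-≤ 3 stal))))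
        where
        budget : ∀ j → suc (4 * suc j) ≡ suc (4 * j) + 4
        budget = solve-∀

      positive-after : ∀ j {a b} → suc (4 * suc j) ≤ a → a ≤ b + 3 → 1 ≤ b
      positive-after j {a} {b} Ψ≥ dom =
        +-cancelʳ-≤ 3 1 b (≤-trans (≤-trans (subst (4 ≤_) (budget j) (m≤m+n 4 _)) Ψ≥) dom)
        where
        budget : ∀ j → 4 + suc (4 * j) ≡ suc (4 * suc j)
        budget = solve-∀

    dominatorTurn : ∀ j {S} → suc (4 * j) ≤ Ψ S → MaxD (suc (j + j)) S
    dominatorTurn zero Ψ≥ = moveD (available Ψ≥) (λ _ _ → zeroS)
    dominatorTurn (suc j) {S} Ψ≥ = moveD (available (≤-trans (s≤s z≤n) Ψ≥)) stallerReply
      where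
      stallerReply : ∀ v → Legal S v → MaxS (suc j + suc j) (v ∷ S)
      stallerReply v _ with slow-drop {v} {S} (positive-after j Ψ≥ (any-drop S v))
      ... | x , legal , drop =
        moveS x legal (subst (λ m → MaxD m (x ∷ v ∷ S)) (sym (+-suc j j))
          (dominatorTurn j (round-bound j Ψ≥ (any-drop S v) drop)))

-- Runs of white path vertices.  runWeight (b i) (b (i-1)) is 3 at the first vertex
-- of a run, 1 at the others and 0 off the runs, so summing it counts every white
-- vertex once and every run twice more.
runWeight : Bool → Bool → ℕ
runWeight true false = 3
runWeight true true = 1
runWeight false _ = 0

-- The total runWeight of four consecutive positions c … c+3 with flags B, C, D, E,
-- where a is the flag of c-1.
window : Bool → Bool → Bool → Bool → Bool → ℕ
window a B C D E = runWeight B a + (runWeight C B + (runWeight D C + runWeight E D))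

-- After c, c+1, c+2 are cleared only runWeight E false remains of the window.  This
-- drops the window by at least 1 if one of the cleared positions was white …
window-drop-white : ∀ a B C D E → B ∨ (C ∨ D) ≡ true → runWeight E false + 1 ≤ window a B C D E
window-drop-white a B C D E white = ≤ᵇ⇒≤ _ _ (T-⇒ _ _ (∀ᵇ⁵-sound
  (λ a B C D E → not (B ∨ (C ∨ D)) ∨ ((runWeight E false + 1) ≤ᵇ window a B C D E)) tt a B C D E) white)

window-drop-start : ∀ a B C D E → B ≡ true → a ≡ false → runWeight E false + 3 ≤ window a B C D E
window-drop-start a B C D E start notBefore = ≤ᵇ⇒≤ _ _ (T-⇒ _ _ (∀ᵇ⁵-sound
  (λ a B C D E → not (B ∧ not a) ∨ ((runWeight E false + 3) ≤ᵇ window a B C D E)) tt a B C D E)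
  (cong₂ (λ x y → x ∧ not y) start notBefore))

-- Both strategies on the hatted cycle Ĉ_{4k+1}.
module HattedCycle (k : ℕ) (k≥1 : 1 ≤ k) where
  G : Graph
  G = hatC k k≥1
  open Game G
  open Strategies G

  -- Vertex codes: 0 … K are the cycle vertices (K = 4k) and N = 4k+1 is the hat,
  -- adjacent to 0 and 2; there are N + 1 = 4k+2 vertices.
  K : ℕ
  K = 4 * k
  N : ℕ
  N = 4 * k + 1

  4≤K : 4 ≤ K
  4≤K = *-monoʳ-≤ 4 k≥1
  N≡1+K : N ≡ suc K
  N≡1+K = +-comm K 1
  N∸1≡K : N ∸ 1 ≡ K
  N∸1≡K = m+n∸n≡m K 1
  K<N : K < N
  K<N = m<m+n K (s≤s z≤n)
  <N⇒≤K : ∀ {i} → i < N → i ≤ K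
  <N⇒≤K {i} p = ≤-pred (subst (i <_) N≡1+K p)
  ≤K⇒<N : ∀ {i} → i ≤ K → i < N
  ≤K⇒<N {i} p = subst (i <_) (sym N≡1+K) (s≤s p)
  <K⇒<N : ∀ {i} → i < K → i < N
  <K⇒<N p = <-trans p K<N
  <N⇒<n : ∀ {i} → i < N → i < 4 * k + 2
  <N⇒<n p = ≤-trans p (+-monoʳ-≤ K (s≤s z≤n))
  <n⇒≤N : ∀ {j} → j < 4 * k + 2 → j ≤ N
  <n⇒≤N {j} p = ≤-pred (subst (suc j ≤_) (+-suc K 1) p)
  <n⇒≢N⇒<N : ∀ {j} → j < 4 * k + 2 → j ≢ N → j < N
  <n⇒≢N⇒<N p ne = ≤∧≢⇒< (<n⇒≤N p) ne
  <K⇒≢K : ∀ {i} → i < K → i ≢ K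
  <K⇒≢K p refl = <-irrefl refl p
  <K⇒≢N : ∀ {i} → i < K → i ≢ N
  <K⇒≢N p refl = <-asym p K<N
  N≢0 : N ≢ 0
  N≢0 e = 1+n≢0 (trans (sym N≡1+K) e)
  0<K : 0 < K
  0<K = ≤-trans (s≤s z≤n) 4≤K
  1<K : 1 < K
  1<K = ≤-trans (s≤s (s≤s z≤n)) 4≤K

  vertex : (i : ℕ) → i < 4 * k + 2 → V
  vertex i p = fromℕ< p

  DomN : ℕ → ℕ → Set
  DomN j i = (j ≡ i) ⊎ hatAdjℕ N j i

  dom? : ∀ j i → Dec (DomN j i)
  dom? j i = (j ≟ i) ⊎-dec
    (((j <? N) ×-dec ((i <? N) ×-dec ((i ≟ suc j) ⊎-dec ((j ≟ suc i) ⊎-dec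
        (((j ≟ 0) ×-dec (i ≟ N ∸ 1)) ⊎-dec ((i ≟ 0) ×-dec (j ≟ N ∸ 1)))))))
     ⊎-dec (((j ≟ N) ×-dec ((i ≟ 0) ⊎-dec (i ≟ 2))) ⊎-dec ((i ≟ N) ×-dec ((j ≟ 0) ⊎-dec (j ≟ 2)))))

  DomN-sym : ∀ {a b} → DomN a b → DomN b a
  DomN-sym (inj₁ e) = inj₁ (sym e)
  DomN-sym (inj₂ a) = inj₂ (hatAdjℕ-sym N a)

  domFin : ∀ {v u} → Dom v u → DomN (toℕ v) (toℕ u)
  domFin (inj₁ refl) = inj₁ refl
  domFin (inj₂ a) = inj₂ a

  finDom : ∀ {v u} → DomN (toℕ v) (toℕ u) → Dom v u
  finDom (inj₁ e) = inj₁ (toℕ-injective e)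
  finDom (inj₂ a) = inj₂ a

  status : ∀ S → AllDominated S ⊎ Σ V λ u → ¬ Dominated S u
  status = gameStatus λ v u → map′ finDom domFin (dom? (toℕ v) (toℕ u))

  white : List V → ℕ → Bool
  white [] i = true
  white (v ∷ S) i = white S i ∧ not (does (dom? (toℕ v) i))

  white-∷ : ∀ {v S i} → white (v ∷ S) i ≡ true → white S i ≡ true
  white-∷ {v} {S} {i} e with white S i
  ... | true = refl

  played-dominates : ∀ {S p i} → p ∈ S → DomN (toℕ p) i → white S i ≡ false
  played-dominates {p ∷ S} {i = i} (here refl) d rewrite dec-true (dom? (toℕ p) i) d = ∧-zeroʳ (white S i)
  played-dominates {x ∷ S} (there m) d rewrite played-dominates {S} m d = refl

  nonwhite-dominator : ∀ S i → white S i ≡ false → Σ V λ p → p ∈ S × DomN (toℕ p) i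
  nonwhite-dominator [] i ()
  nonwhite-dominator (v ∷ S) i e with white S i in eq
  ... | false with nonwhite-dominator S i eq
  ...   | p , m , d = p , there m , d
  nonwhite-dominator (v ∷ S) i e | true = v , here refl , does-sound (dom? (toℕ v) i) (not-false e)
    where
    not-false : ∀ {x} → not x ≡ false → x ≡ true
    not-false {true} _ = refl

  white⇒¬Dominated : ∀ {S u} → white S (toℕ u) ≡ true → ¬ Dominated S u
  white⇒¬Dominated e (p , m , d) with trans (sym (played-dominates m (domFin d))) e
  ... | ()

  ¬Dominated⇒white : ∀ {S u} → ¬ Dominated S u → white S (toℕ u) ≡ true
  ¬Dominated⇒white {S} {u} ¬d with white S (toℕ u) in eq
  ... | true = refl
  ... | false with nonwhite-dominator S (toℕ u) eq
  ...   | p , m , d = ⊥-elim (¬d (p , m , finDom d))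

  white-vertex : ∀ {S i} (p : i < 4 * k + 2) → white S i ≡ true → white S (toℕ (vertex i p)) ≡ true
  white-vertex {S} p = subst (λ x → white S x ≡ true) (sym (toℕ-fromℕ< p))

  legal-at : ∀ {S v} (u : V) → DomN (toℕ v) (toℕ u) → white S (toℕ u) ≡ true → Legal S v
  legal-at u d e = u , finDom d , white⇒¬Dominated e

  OnPath : ℕ → Set
  OnPath i = 2 ≤ i × i < K

  OnPath? : ∀ i → Dec (OnPath i)
  OnPath? i = (2 ≤? i) ×-dec (i <? K)

  onPath : ℕ → Bool
  onPath i = does (OnPath? i)

  onPath-intro : ∀ {i} → OnPath i → onPath i ≡ true
  onPath-intro {i} = dec-true (OnPath? i)

  pathWhite : List V → ℕ → Bool
  pathWhite S i = onPath i ∧ white S i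

  pathWhite⇒OnPath : ∀ {S i} → pathWhite S i ≡ true → OnPath i
  pathWhite⇒OnPath {S} {i} e with onPath i in eq
  ... | true = does-sound (OnPath? i) eq

  pathWhite⇒white : ∀ {S i} → pathWhite S i ≡ true → white S i ≡ true
  pathWhite⇒white {S} {i} e with onPath i
  ... | true = e

  -- Dominator's potential: Φ S = (white path vertices) + 2 · (runs of them).  The
  -- range runs to K+2 so that every window c … c+3 with c < K lies inside it.
  weight : List V → ℕ → ℕ
  weight S i = runWeight (pathWhite S i) (pathWhite S (pred i))

  M : ℕ
  M = 4 * k + 3

  Φ : List V → ℕ
  Φ S = sumRange (weight S) 0 M

  -- A move that clears the window c, c+1, c+2 of the path and nothing else changes
  -- Φ only on the positions c … c+3.
  InWindow : ℕ → ℕ → Set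
  InWindow c i = i ≡ c ⊎ i ≡ suc c ⊎ i ≡ suc (suc c)

  Clears : ℕ → List V → List V → Set
  Clears c S S' = (∀ i → InWindow c i → pathWhite S' i ≡ false)
                × (∀ i → ¬ InWindow c i → pathWhite S' i ≡ pathWhite S i)

  InWindow-bounds : ∀ {c i} → InWindow c i → c ≤ i × i ≤ 2 + c
  InWindow-bounds {c} (inj₁ refl) = ≤-refl , m≤n+m c 2
  InWindow-bounds {c} (inj₂ (inj₁ refl)) = n≤1+n c , s≤s (n≤1+n c)
  InWindow-bounds {c} (inj₂ (inj₂ refl)) = ≤-trans (n≤1+n c) (n≤1+n (suc c)) , ≤-refl

  weight-outside : ∀ {c S S'} → Clears c S S' → ∀ i → (i < c ⊎ 4 + c ≤ i) → weight S' i ≡ weight S i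
  weight-outside {c} (_ , keep) i (inj₁ i<c) =
    cong₂ runWeight (keep i (before i<c)) (keep (pred i) (before (≤-<-trans pred[n]≤n i<c)))
    where
    before : ∀ {i} → i < c → ¬ InWindow c i
    before i<c w = <⇒≱ i<c (proj₁ (InWindow-bounds w))
  weight-outside {c} (_ , keep) (suc i) (inj₂ 4+c≤i) =
    cong₂ runWeight (keep (suc i) (after (≤-trans (n≤1+n _) 4+c≤i))) (keep i (after (≤-pred 4+c≤i)))
    where
    after : ∀ {i} → 3 + c ≤ i → ¬ InWindow c i
    after p w = <⇒≱ p (proj₂ (InWindow-bounds w))

  windowSum-after : ∀ {c S S'} → Clears c S S' →
    windowSum (weight S') c ≡ runWeight (pathWhite S (suc (suc (suc c)))) false
  windowSum-after {c} (clear , keep)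
    rewrite clear c (inj₁ refl) | clear (suc c) (inj₂ (inj₁ refl)) | clear (suc (suc c)) (inj₂ (inj₂ refl))
          | keep (suc (suc (suc c))) (λ w → 1+n≰n (proj₂ (InWindow-bounds w))) = refl

  Φ-window : ∀ S S' c δ → c + 4 ≤ M → Clears c S S' →
    runWeight (pathWhite S (suc (suc (suc c)))) false + δ ≤ windowSum (weight S) c → Φ S' + δ ≤ Φ S
  Φ-window S S' c δ fits cl local with m≤n⇒∃[o]m+o≡n fits
  ... | r , c+4+r≡M = begin
      Φ S' + δ
        ≡⟨ cong (λ m → sumRange (weight S') 0 m + δ) M≡ ⟩
      sumRange (weight S') 0 (c + (4 + r)) + δ
        ≡⟨ cong (_+ δ) (sumRange-window (weight S') c r) ⟩
      sumRange (weight S') 0 c + (windowSum (weight S') c + sumRange (weight S') (4 + c) r) + δ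
        ≡⟨ cong (_+ δ) (cong₂ _+_ before (cong₂ _+_ (windowSum-after {c} {S} {S'} cl) after)) ⟩
      A + (E + B) + δ
        ≡⟨ shuffle A B E δ ⟩
      A + ((E + δ) + B)
        ≤⟨ +-monoʳ-≤ A (+-monoˡ-≤ B local) ⟩
      A + (windowSum (weight S) c + B)
        ≡⟨ sym (sumRange-window (weight S) c r) ⟩
      sumRange (weight S) 0 (c + (4 + r))
        ≡⟨ cong (sumRange (weight S) 0) (sym M≡) ⟩
      Φ S ∎
    where
    open ≤-Reasoning
    A B E : ℕ
    A = sumRange (weight S) 0 c
    B = sumRange (weight S) (4 + c) r
    E = runWeight (pathWhite S (suc (suc (suc c)))) false
    M≡ : M ≡ c + (4 + r)
    M≡ = trans (sym c+4+r≡M) (+-assoc c 4 r)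
    before : sumRange (weight S') 0 c ≡ A
    before = sumRange-cong (weight S') (weight S) 0 c (λ i r → weight-outside {c} {S} {S'} cl i (inj₁ (proj₂ r)))
    after : sumRange (weight S') (4 + c) r ≡ B
    after = sumRange-cong (weight S') (weight S) (4 + c) r (λ i r → weight-outside {c} {S} {S'} cl i (inj₂ (proj₁ r)))
    shuffle : ∀ A B E δ → A + (E + B) + δ ≡ A + ((E + δ) + B)
    shuffle = solve-∀

  path-dominator : ∀ j i → OnPath i → DomN j i →
    (j ≡ N × i ≡ 2) ⊎ Σ ℕ λ c → j ≡ suc c × suc c ≤ K × InWindow c i
  path-dominator j zero (() , _) d
  path-dominator j (suc zero) (s≤s () , _) d
  path-dominator j (suc (suc i)) (_ , i<K) (inj₁ refl) =
    inj₂ (suc i , refl , <⇒≤ i<K , inj₂ (inj₁ refl))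
  path-dominator j (suc (suc i)) (_ , i<K) (inj₂ (inj₁ (_ , _ , inj₁ refl))) =
    inj₂ (i , refl , ≤-trans (n≤1+n _) (<⇒≤ i<K) , inj₂ (inj₂ refl))
  path-dominator j (suc (suc i)) (_ , i<K) (inj₂ (inj₁ (_ , _ , inj₂ (inj₁ refl)))) =
    inj₂ (suc (suc i) , refl , i<K , inj₁ refl)
  path-dominator j (suc (suc i)) (_ , i<K) (inj₂ (inj₁ (_ , _ , inj₂ (inj₂ (inj₁ (_ , e)))))) =
    ⊥-elim (<K⇒≢K i<K (trans e N∸1≡K))
  path-dominator j (suc (suc i)) _ (inj₂ (inj₂ (inj₁ (e , inj₂ e₂)))) = inj₁ (e , e₂)
  path-dominator j (suc (suc i)) (_ , i<K) (inj₂ (inj₂ (inj₂ (e , _)))) = ⊥-elim (<K⇒≢N i<K e)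

  move-clears : ∀ S v c → (∀ i → OnPath i → InWindow c i → DomN (toℕ v) i) →
    (∀ i → OnPath i → DomN (toℕ v) i → InWindow c i) → Clears c S (v ∷ S)
  move-clears S v c inside outside =
      (λ i w → cleared (onPath i) (white S i) _
                 (λ e → dec-true (dom? (toℕ v) i) (inside i (does-sound (OnPath? i) e) w)))
    , (λ i ¬w → kept (onPath i) (white S i) _
                 (λ e → dec-false (dom? (toℕ v) i) (λ d → ¬w (outside i (does-sound (OnPath? i) e) d))))
    where
    cleared : ∀ p x d → (p ≡ true → d ≡ true) → p ∧ (x ∧ not d) ≡ false
    cleared false x d h = refl
    cleared true x d h rewrite h refl = ∧-zeroʳ x
    kept : ∀ p x d → (p ≡ true → d ≡ false) → p ∧ (x ∧ not d) ≡ p ∧ x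
    kept false x d h = refl
    kept true x d h rewrite h refl = ∧-identityʳ x

  cycle-move-clears : ∀ S v c → toℕ v ≡ suc c → suc c ≤ K → Clears c S (v ∷ S)
  cycle-move-clears S v c v≡ c+1≤K = move-clears S v c
    (λ i path w → subst (λ j → DomN j i) (sym v≡) (inside i path w))
    (λ i path d → outside i path (subst (λ j → DomN j i) v≡ d))
    where
    c+1<N : suc c < N
    c+1<N = ≤K⇒<N c+1≤K
    inside : ∀ i → OnPath i → InWindow c i → DomN (suc c) i
    inside i _ (inj₁ refl) = inj₂ (inj₁ (c+1<N , <-trans (n<1+n c) c+1<N , inj₂ (inj₁ refl)))
    inside i _ (inj₂ (inj₁ refl)) = inj₁ refl
    inside i (_ , i<K) (inj₂ (inj₂ refl)) = inj₂ (inj₁ (c+1<N , <K⇒<N i<K , inj₁ refl))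
    outside : ∀ i → OnPath i → DomN (suc c) i → InWindow c i
    outside i path d with path-dominator (suc c) i path d
    ... | inj₁ (e , _) = ⊥-elim (<⇒≢ c+1<N e)
    ... | inj₂ (_ , refl , _ , w) = w

  hat-move-clears : ∀ S v → toℕ v ≡ N → Clears 0 S (v ∷ S)
  hat-move-clears S v v≡ = move-clears S v 0
    (λ i path w → subst (λ j → DomN j i) (sym v≡) (inside i path w))
    (λ i path d → outside i path (subst (λ j → DomN j i) v≡ d))
    where
    inside : ∀ i → OnPath i → InWindow 0 i → DomN N i
    inside i (() , _) (inj₁ refl)
    inside i (s≤s () , _) (inj₂ (inj₁ refl))
    inside i _ (inj₂ (inj₂ refl)) = inj₂ (inj₂ (inj₁ (refl , inj₂ refl)))
    outside : ∀ i → OnPath i → DomN N i → InWindow 0 i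
    outside i path d with path-dominator N i path d
    ... | inj₁ (_ , i≡2) = inj₂ (inj₂ i≡2)
    ... | inj₂ (c , N≡ , c+1≤K , _) = ⊥-elim (<⇒≱ K<N (subst (_≤ K) (sym N≡) c+1≤K))

  window-fits : ∀ c → suc c ≤ K → c + 4 ≤ M
  window-fits c c+1≤K = subst (_≤ M) (sym (+-suc c 3)) (+-monoˡ-≤ 3 c+1≤K)

  clearing-drop : ∀ S v c → suc c ≤ K → Clears c S (v ∷ S) → ∀ i → InWindow c i →
    pathWhite S i ≡ true → Φ (v ∷ S) + 1 ≤ Φ S
  clearing-drop S v c c+1≤K cl i w white-i =
    Φ-window S (v ∷ S) c 1 (window-fits c c+1≤K) cl
      (window-drop-white (pathWhite S (pred c)) (pathWhite S c) (pathWhite S (suc c)) (pathWhite S (suc (suc c)))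
                         (pathWhite S (suc (suc (suc c)))) (some-white w white-i))
    where
    some-white : ∀ {i} → InWindow c i → pathWhite S i ≡ true →
      pathWhite S c ∨ (pathWhite S (suc c) ∨ pathWhite S (suc (suc c))) ≡ true
    some-white (inj₁ refl) e rewrite e = refl
    some-white (inj₂ (inj₁ refl)) e rewrite e = ∨-zeroʳ (pathWhite S c)
    some-white (inj₂ (inj₂ refl)) e rewrite e | ∨-zeroʳ (pathWhite S (suc c)) = ∨-zeroʳ (pathWhite S c)

  PathOnly : List V → Set
  PathOnly S = ∀ i → i < 4 * k + 2 → white S i ≡ true → OnPath i

  PathOnly-∷ : ∀ {S} v → PathOnly S → PathOnly (v ∷ S)
  PathOnly-∷ {S} v inv i p e = inv i p (white-∷ {v} {S} {i} e)

  PathOnly-pathWhite : ∀ {S} → PathOnly S → ∀ u → white S (toℕ u) ≡ true → pathWhite S (toℕ u) ≡ true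
  PathOnly-pathWhite {S} inv u e rewrite onPath-intro (inv (toℕ u) (toℕ<n u) e) | e = refl

  -- every move lowers Φ by at least 1: it dominates a white path vertex, so it is the
  -- hat (clearing window 0) or a cycle vertex whose window contains that vertex
  every-move-drop : ∀ {S v} → PathOnly S → Legal S v → Φ (v ∷ S) + 1 ≤ Φ S
  every-move-drop {S} {v} inv (u , d , ¬d) = by-dominator (PathOnly-pathWhite {S} inv u (¬Dominated⇒white {S} ¬d))
    where
    by-dominator : pathWhite S (toℕ u) ≡ true → Φ (v ∷ S) + 1 ≤ Φ S
    by-dominator white-u with path-dominator (toℕ v) (toℕ u) (pathWhite⇒OnPath {S} white-u) (domFin d)
    ... | inj₁ (v≡N , u≡2) =
      clearing-drop S v 0 0<K (hat-move-clears S v v≡N) (toℕ u) (inj₂ (inj₂ u≡2)) white-u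
    ... | inj₂ (c , v≡ , c+1≤K , w) =
      clearing-drop S v c c+1≤K (cycle-move-clears S v c v≡ c+1≤K) (toℕ u) w white-u

  run-start : ∀ S n → pathWhite S n ≡ true → Σ ℕ λ i → pathWhite S i ≡ true × pathWhite S (pred i) ≡ false
  run-start S zero ()
  run-start S (suc n) e with pathWhite S n in eq
  ... | true = run-start S n eq
  ... | false = suc n , e , eq

  -- playing the successor i+1 of the first vertex i of a run lowers Φ by at least 3
  run-start-move : ∀ S i → pathWhite S i ≡ true → pathWhite S (pred i) ≡ false →
    Σ V λ v → Legal S v × Φ (v ∷ S) + 3 ≤ Φ S
  run-start-move S i start before =
    v , legal-at {S} {v} (vertex i i<n) dominates (white-vertex {S} i<n (pathWhite⇒white {S} start))
      , Φ-window S (v ∷ S) i 3 (window-fits i i<K) (cycle-move-clears S v i (toℕ-fromℕ< i+1<n) i<K)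
          (window-drop-start (pathWhite S (pred i)) (pathWhite S i) (pathWhite S (suc i)) (pathWhite S (suc (suc i)))
                             (pathWhite S (suc (suc (suc i)))) start before)
    where
    i<K : i < K
    i<K = proj₂ (pathWhite⇒OnPath {S} start)
    i<n : i < 4 * k + 2
    i<n = <N⇒<n (<K⇒<N i<K)
    i+1<n : suc i < 4 * k + 2
    i+1<n = <N⇒<n (≤K⇒<N i<K)
    v : V
    v = vertex (suc i) i+1<n
    dominates : DomN (toℕ v) (toℕ (vertex i i<n))
    dominates = subst₂ DomN (sym (toℕ-fromℕ< i+1<n)) (sym (toℕ-fromℕ< i<n))
                  (inj₂ (inj₁ (≤K⇒<N i<K , <K⇒<N i<K , inj₂ (inj₁ refl))))

  good-move : ∀ {S u} → PathOnly S → ¬ Dominated S u → Σ V λ v → Legal S v × Φ (v ∷ S) + 3 ≤ Φ S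
  good-move {S} {u} inv ¬d with run-start S (toℕ u) (PathOnly-pathWhite {S} inv u (¬Dominated⇒white {S} ¬d))
  ... | i , start , before = run-start-move S i start before

  0<n : 0 < 4 * k + 2
  0<n = <N⇒<n (≤K⇒<N z≤n)

  opening : V
  opening = vertex 0 0<n

  toℕ-opening : toℕ opening ≡ 0
  toℕ-opening = toℕ-fromℕ< 0<n

  opening-legal : Legal [] opening
  opening-legal = legal-at {[]} {opening} opening (inj₁ refl) refl

  opening-dominates : ∀ i → i < 4 * k + 2 → ¬ OnPath i → DomN 0 i
  opening-dominates zero _ _ = inj₁ refl
  opening-dominates (suc zero) _ _ = inj₂ (inj₁ (≤K⇒<N z≤n , <K⇒<N 1<K , inj₁ refl))
  opening-dominates (suc (suc i)) i<n ¬path with suc (suc i) <? K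
  ... | yes i<K = ⊥-elim (¬path (s≤s (s≤s z≤n) , i<K))
  ... | no i≮K with m≤n⇒m<n∨m≡n (≮⇒≥ i≮K)
  ...   | inj₂ K≡i =
    subst (DomN 0) K≡i (inj₂ (inj₁ (≤K⇒<N z≤n , K<N , inj₂ (inj₂ (inj₁ (refl , sym N∸1≡K))))))
  ...   | inj₁ K<i = subst (DomN 0) (≤-antisym (subst (_≤ suc (suc i)) (sym N≡1+K) K<i) (<n⇒≤N i<n))
                       (inj₂ (inj₂ (inj₂ (refl , inj₁ refl))))

  opening-misses : ∀ i → OnPath i → ¬ DomN 0 i
  opening-misses i path d with path-dominator 0 i path d
  ... | inj₁ (0≡N , _) = N≢0 (sym 0≡N)
  ... | inj₂ (_ , () , _)

  PathOnly-opening : PathOnly (opening ∷ [])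
  PathOnly-opening i i<n e rewrite toℕ-opening with OnPath? i
  ... | yes path = path
  ... | no ¬path with trans (sym e) (cong not (dec-true (dom? 0 i) (opening-dominates i i<n ¬path)))
  ...   | ()

  pathWhite-opening : ∀ i → pathWhite (opening ∷ []) i ≡ onPath i
  pathWhite-opening i rewrite toℕ-opening with OnPath? i
  ... | yes path rewrite dec-false (dom? 0 i) (opening-misses i path) = ∧-identityʳ (onPath i)
  ... | no ¬path rewrite dec-false (OnPath? i) ¬path = refl

  -- after the opening the white vertices form the single run 2, …, K-1,
  -- so Φ = 3 + (K - 3) · 1 = K
  Φ-opening : Φ (opening ∷ []) ≡ K
  Φ-opening with m≤n⇒∃[o]m+o≡n (≤-trans (n≤1+n 3) 4≤K)
  ... | q , 3+q≡K = begin
    Φ (opening ∷ [])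
      ≡⟨ sumRange-cong (weight (opening ∷ [])) w₀ 0 M
           (λ i _ → cong₂ runWeight (pathWhite-opening i) (pathWhite-opening (pred i))) ⟩
    sumRange w₀ 0 M
      ≡⟨ cong (sumRange w₀ 0) M≡ ⟩
    sumRange w₀ 0 (2 + (1 + (q + 3)))
      ≡⟨ sumRange-split w₀ 0 2 (1 + (q + 3)) ⟩
    runWeight (onPath 2) false + sumRange w₀ 3 (q + 3)
      ≡⟨ cong₂ _+_ (cong (λ b → runWeight b false) (onPath-intro (≤-refl , ≤-trans (s≤s (s≤s (s≤s z≤n))) 4≤K)))
                   (sumRange-split w₀ 3 q 3) ⟩
    3 + (sumRange w₀ 3 q + sumRange w₀ (3 + q) 3)
      ≡⟨ cong₂ (λ x y → 3 + (x + y)) (sumRange-const w₀ 3 q 1 inside) (sumRange-const w₀ (3 + q) 3 0 beyond) ⟩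
    3 + (q * 1 + 0)
      ≡⟨ cong (3 +_) (trans (+-identityʳ (q * 1)) (*-identityʳ q)) ⟩
    3 + q
      ≡⟨ 3+q≡K ⟩
    K ∎
    where
    open ≡-Reasoning
    w₀ : ℕ → ℕ
    w₀ i = runWeight (onPath i) (onPath (pred i))
    M≡ : M ≡ 2 + (1 + (q + 3))
    M≡ = trans (cong (_+ 3) (sym 3+q≡K)) (shuffle q)
      where
      shuffle : ∀ q → 3 + q + 3 ≡ 2 + (1 + (q + 3))
      shuffle = solve-∀
    inside : ∀ i → InRange 3 q i → w₀ i ≡ 1
    inside (suc i) (s≤s 2≤i , i<K)
      rewrite onPath-intro {suc i} (≤-trans (n≤1+n 2) (s≤s 2≤i) , subst (suc i <_) 3+q≡K i<K)
            | onPath-intro {i} (2≤i , <-trans (n<1+n i) (subst (suc i <_) 3+q≡K i<K)) = refl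
    beyond : ∀ i → InRange (3 + q) 3 i → w₀ i ≡ 0
    beyond i (K≤i , _) rewrite dec-false (OnPath? i) (λ (_ , i<K) → <⇒≱ i<K (subst (_≤ i) 3+q≡K K≤i)) = refl

  -- Dominator opens at 0 and then keeps Φ ≤ 2m with m moves to go
  open DominatorPotential status PathOnly Φ (λ {S} → PathOnly-∷ {S}) every-move-drop good-move using (stallerTurn)

  upper : MinD (2 * k + 1) []
  upper = subst (λ m → MinD m []) (two-k+1 k)
    (moveD opening opening-legal (stallerTurn (k + k) PathOnly-opening (≤-reflexive (trans Φ-opening (four-k k)))))
    where
    two-k+1 : ∀ k → suc (k + k) ≡ 2 * k + 1
    two-k+1 = solve-∀
    four-k : ∀ k → 4 * k ≡ k + k + (k + k)
    four-k = solve-∀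

  Ψ : List V → ℕ
  Ψ S = sumRange (λ i → bit (white S i)) 0 N

  Ψ-drop : ∀ S v (Q : ℕ → ℕ) → (∀ i → i < N → white S i ≡ true → DomN (toℕ v) i → 1 ≤ Q i) →
           Ψ S ≤ Ψ (v ∷ S) + sumRange Q 0 N
  Ψ-drop S v Q charged =
    ≤-trans (sumRange-mono _ _ 0 N pointwise) (≤-reflexive (sumRange-+ (λ i → bit (white (v ∷ S) i)) Q 0 N))
    where
    pointwise : ∀ i → InRange 0 N i → bit (white S i) ≤ bit (white S i ∧ not (does (dom? (toℕ v) i))) + Q i
    pointwise i (_ , i<N) with white S i in e | does (dom? (toℕ v) i) in d
    ... | false | _ = z≤n
    ... | true | false = s≤s z≤n
    ... | true | true = charged i i<N e (does-sound (dom? (toℕ v) i) d)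

  next : ℕ → ℕ
  next j with j ≟ K
  ... | yes _ = 0
  ... | no _ = suc j

  prev : ℕ → ℕ
  prev zero = K
  prev (suc j) = j

  next-<K : ∀ {i} → i < K → next i ≡ suc i
  next-<K {i} i<K with i ≟ K
  ... | yes i≡K = ⊥-elim (<K⇒≢K i<K i≡K)
  ... | no _ = refl

  next-K : next K ≡ 0
  next-K with K ≟ K
  ... | yes _ = refl
  ... | no K≢K = ⊥-elim (K≢K refl)

  next-adjacent : ∀ {i} → i < N → next i < N × DomN i (next i)
  next-adjacent {i} i<N with m≤n⇒m<n∨m≡n (<N⇒≤K i<N)
  ... | inj₁ i<K rewrite next-<K i<K = ≤K⇒<N i<K , inj₂ (inj₁ (i<N , ≤K⇒<N i<K , inj₁ refl))
  ... | inj₂ refl rewrite next-K =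
    ≤K⇒<N z≤n , inj₂ (inj₁ (i<N , ≤K⇒<N z≤n , inj₂ (inj₂ (inj₂ (refl , sym N∸1≡K)))))

  cycle-neighbourhood : ∀ j i → j < N → i < N → DomN j i → i ≡ j ⊎ i ≡ next j ⊎ i ≡ prev j
  cycle-neighbourhood j i _ _ (inj₁ e) = inj₁ (sym e)
  cycle-neighbourhood j i j<N i<N (inj₂ (inj₁ (_ , _ , inj₁ e))) with m≤n⇒m<n∨m≡n (<N⇒≤K j<N)
  ... | inj₁ j<K = inj₂ (inj₁ (trans e (sym (next-<K j<K))))
  ... | inj₂ refl = ⊥-elim (<-irrefl (trans e (sym N≡1+K)) i<N)
  cycle-neighbourhood j i _ _ (inj₂ (inj₁ (_ , _ , inj₂ (inj₁ refl)))) = inj₂ (inj₂ refl)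
  cycle-neighbourhood j i _ _ (inj₂ (inj₁ (_ , _ , inj₂ (inj₂ (inj₁ (refl , e)))))) =
    inj₂ (inj₂ (trans e N∸1≡K))
  cycle-neighbourhood j i _ _ (inj₂ (inj₁ (_ , _ , inj₂ (inj₂ (inj₂ (i≡0 , e)))))) =
    inj₂ (inj₁ (trans i≡0 (sym (trans (cong next (trans e N∸1≡K)) next-K))))
  cycle-neighbourhood j i j<N _ (inj₂ (inj₂ (inj₁ (e , _)))) = ⊥-elim (<-irrefl e j<N)
  cycle-neighbourhood j i _ i<N (inj₂ (inj₂ (inj₂ (e , _)))) = ⊥-elim (<-irrefl e i<N)

  hat-neighbourhood : ∀ i → i < N → DomN N i → i ≡ 0 ⊎ i ≡ 2
  hat-neighbourhood i i<N (inj₁ e) = ⊥-elim (<-irrefl (sym e) i<N)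
  hat-neighbourhood i i<N (inj₂ (inj₁ (N<N , _))) = ⊥-elim (<-irrefl refl N<N)
  hat-neighbourhood i i<N (inj₂ (inj₂ (inj₁ (_ , d)))) = d
  hat-neighbourhood i i<N (inj₂ (inj₂ (inj₂ (e , _)))) = ⊥-elim (<-irrefl e i<N)

  hat-dominates : ∀ {p : V} → toℕ p ≡ N → ∀ {i} → i ≡ 0 ⊎ i ≡ 2 → DomN (toℕ p) i
  hat-dominates p≡N {i} d = subst (λ x → DomN x i) (sym p≡N) (inj₂ (inj₂ (inj₁ (refl , d))))

  at-most-three : ∀ j → j < 4 * k + 2 → Σ ℕ λ q₁ → Σ ℕ λ q₂ → Σ ℕ λ q₃ →
    ∀ i → i < N → DomN j i → i ≡ q₁ ⊎ i ≡ q₂ ⊎ i ≡ q₃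
  at-most-three j j<n with j ≟ N
  ... | yes refl = 0 , 2 , 2 , λ i i<N d → map₂ inj₁ (hat-neighbourhood i i<N d)
  ... | no j≢N = j , next j , prev j , λ i i<N d → cycle-neighbourhood j i (<n⇒≢N⇒<N j<n j≢N) i<N d

  Ψ-drop≤3 : ∀ S v → Ψ S ≤ Ψ (v ∷ S) + 3
  Ψ-drop≤3 S v with at-most-three (toℕ v) (toℕ<n v)
  ... | q₁ , q₂ , q₃ , among =
    ≤-trans (Ψ-drop S v Q charged) (+-monoʳ-≤ (Ψ (v ∷ S)) (≤-trans (≤-reflexive total)
      (+-mono-≤ (sumRange-point q₁ 1 0 N) (+-mono-≤ (sumRange-point q₂ 1 0 N) (sumRange-point q₃ 1 0 N)))))
    where
    Q : ℕ → ℕ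
    Q i = point q₁ 1 i + (point q₂ 1 i + point q₃ 1 i)
    charged : ∀ i → i < N → white S i ≡ true → DomN (toℕ v) i → 1 ≤ Q i
    charged i i<N _ d with among i i<N d
    ... | inj₁ e = ≤-trans (point-hit 1 i e) (m≤m+n _ _)
    ... | inj₂ (inj₁ e) =
      ≤-trans (point-hit 1 i e) (≤-trans (m≤m+n _ (point q₃ 1 i)) (m≤n+m _ (point q₁ 1 i)))
    ... | inj₂ (inj₂ e) =
      ≤-trans (point-hit 1 i e) (≤-trans (m≤n+m _ (point q₂ 1 i)) (m≤n+m _ (point q₁ 1 i)))
    total : sumRange Q 0 N ≡ sumRange (point q₁ 1) 0 N + (sumRange (point q₂ 1) 0 N + sumRange (point q₃ 1) 0 N)
    total = trans (sumRange-+ (point q₁ 1) _ 0 N) (cong (_ +_) (sumRange-+ (point q₂ 1) (point q₃ 1) 0 N))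

  Boundary : List V → Set
  Boundary S = Σ ℕ λ i → i < N × white S i ≡ false × white S (next i) ≡ true

  boundary-at : ∀ S i → i < K → white S i ≡ false → white S (suc i) ≡ true → Boundary S
  boundary-at S i i<K fi fs = i , <K⇒<N i<K , fi , subst (λ x → white S x ≡ true) (sym (next-<K i<K)) fs

  boundary-exists : ∀ S d j → d < N → j < N → white S d ≡ false → white S j ≡ true → Boundary S
  boundary-exists S d j d<N j<N dom-d white-j with <-cmp d j
  ... | tri≈ _ refl _ with trans (sym dom-d) white-j
  ...   | ()
  boundary-exists S d j d<N j<N dom-d white-j | tri< d<j _ _
    with switch (white S) d (j ∸ d) dom-d (subst (λ x → white S x ≡ true) (sym (m+[n∸m]≡n (<⇒≤ d<j))) white-j)
  ... | i , (_ , i<) , fi , fs =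
    boundary-at S i (<-≤-trans (subst (i <_) (m+[n∸m]≡n (<⇒≤ d<j)) i<) (<N⇒≤K j<N)) fi fs
  boundary-exists S d j d<N j<N dom-d white-j | tri> _ _ j<d with white S K in white-K
  ... | true
    with switch (white S) d (K ∸ d) dom-d
           (subst (λ x → white S x ≡ true) (sym (m+[n∸m]≡n (<N⇒≤K d<N))) white-K)
  ...   | i , (_ , i<) , fi , fs = boundary-at S i (subst (i <_) (m+[n∸m]≡n (<N⇒≤K d<N)) i<) fi fs
  boundary-exists S d j d<N j<N dom-d white-j | tri> _ _ j<d | false with white S 0 in white-0
  ... | true = K , K<N , white-K , subst (λ x → white S x ≡ true) (sym next-K) white-0
  ... | false with switch (white S) 0 j white-0 white-j
  ...   | i , (_ , i<j) , fi , fs = boundary-at S i (<-≤-trans i<j (<N⇒≤K (<-trans j<d d<N))) fi fs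

  CheapMove : List V → Set
  CheapMove S = Σ V λ x → Legal S x × Ψ S ≤ Ψ (x ∷ S) + 1

  single-charge : ∀ S x t → (∀ i → i < N → white S i ≡ true → DomN (toℕ x) i → i ≡ t) →
    Ψ S ≤ Ψ (x ∷ S) + 1
  single-charge S x t only =
    ≤-trans (Ψ-drop S x (point t 1) (λ i i<N w d → point-hit 1 i (only i i<N w d)))
            (+-monoʳ-≤ (Ψ (x ∷ S)) (sumRange-point t 1 0 N))

  white≢dominated : ∀ {b} → b ≡ true → b ≡ false → ∀ {A : Set} → A
  white≢dominated refl ()

  -- if i and prev i are dominated but next i is white, Staller plays i
  cheap-at-boundary : ∀ S i → i < N → white S i ≡ false → white S (prev i) ≡ false →
    white S (next i) ≡ true → CheapMove S
  cheap-at-boundary S i i<N dom-i dom-prev white-next =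
    x , legal-at {S} {x} (vertex (next i) next<n)
          (subst₂ DomN (sym x≡i) (sym (toℕ-fromℕ< next<n)) (proj₂ (next-adjacent i<N)))
          (white-vertex {S} next<n white-next)
      , single-charge S x (next i) only-next
    where
    next<n : next i < 4 * k + 2
    next<n = <N⇒<n (proj₁ (next-adjacent i<N))
    x : V
    x = vertex i (<N⇒<n i<N)
    x≡i : toℕ x ≡ i
    x≡i = toℕ-fromℕ< (<N⇒<n i<N)
    only-next : ∀ i' → i' < N → white S i' ≡ true → DomN (toℕ x) i' → i' ≡ next i
    only-next i' i'<N w d with cycle-neighbourhood i i' i<N i'<N (subst (λ y → DomN y i') x≡i d)
    ... | inj₁ refl = white≢dominated w dom-i
    ... | inj₂ (inj₁ e) = e
    ... | inj₂ (inj₂ refl) = white≢dominated w dom-prev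

  -- if the hat has been played but 1 is white, Staller plays 1 (0 and 2 are dominated)
  cheap-at-1 : ∀ S p → p ∈ S → toℕ p ≡ N → white S 1 ≡ true → CheapMove S
  cheap-at-1 S p p∈S p≡N white-1 =
    x , legal-at {S} {x} x (inj₁ refl) (white-vertex {S} (<N⇒<n (<K⇒<N 1<K)) white-1)
      , single-charge S x 1 only-1
    where
    x : V
    x = vertex 1 (<N⇒<n (<K⇒<N 1<K))
    x≡1 : toℕ x ≡ 1
    x≡1 = toℕ-fromℕ< (<N⇒<n (<K⇒<N 1<K))
    dom-0 : white S 0 ≡ false
    dom-0 = played-dominates p∈S (hat-dominates {p} p≡N (inj₁ refl))
    dom-2 : white S 2 ≡ false
    dom-2 = played-dominates p∈S (hat-dominates {p} p≡N (inj₂ refl))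
    only-1 : ∀ i → i < N → white S i ≡ true → DomN (toℕ x) i → i ≡ 1
    only-1 i i<N w d with cycle-neighbourhood 1 i (<K⇒<N 1<K) i<N (subst (λ y → DomN y i) x≡1 d)
    ... | inj₁ e = e
    ... | inj₂ (inj₁ e) = white≢dominated (subst (λ y → white S y ≡ true) (trans e (next-<K 1<K)) w) dom-2
    ... | inj₂ (inj₂ refl) = white≢dominated w dom-0

  -- at every boundary Staller has a cheap move: if prev i is white, the dominator of
  -- i can only be the hat, so i ∈ {0, 2}, 0 and 2 are dominated and 1 is white
  cheap-move : ∀ S → Boundary S → CheapMove S
  cheap-move S (i , i<N , dom-i , white-next) with white S (prev i) in white-prev
  ... | false = cheap-at-boundary S i i<N dom-i white-prev white-next
  ... | true with nonwhite-dominator S i dom-i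
  ...   | p , p∈S , d with toℕ p ≟ N
  ...     | yes p≡N with hat-neighbourhood i i<N (subst (λ y → DomN y i) p≡N d)
  ...       | inj₁ refl = cheap-at-1 S p p∈S p≡N (subst (λ y → white S y ≡ true) (next-<K 0<K) white-next)
  ...       | inj₂ refl = cheap-at-1 S p p∈S p≡N white-prev
  cheap-move S (i , i<N , dom-i , white-next) | true | p , p∈S , d | no p≢N
    with cycle-neighbourhood i (toℕ p) i<N (<n⇒≢N⇒<N (toℕ<n p) p≢N) (DomN-sym d)
  ... | inj₁ p≡i = white≢dominated white-next
                     (played-dominates p∈S (subst (λ y → DomN y (next i)) (sym p≡i) (proj₂ (next-adjacent i<N))))
  ... | inj₂ (inj₁ p≡next) = white≢dominated white-next (played-dominates p∈S (inj₁ p≡next))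
  ... | inj₂ (inj₂ p≡prev) = white≢dominated white-prev (played-dominates p∈S (inj₁ p≡prev))

  -- after at least one move some cycle vertex is dominated (the move itself, or 0 if it was the hat) …
  dominated-cycle-vertex : ∀ v S → Σ ℕ λ d → d < N × white (v ∷ S) d ≡ false
  dominated-cycle-vertex v S with toℕ v ≟ N
  ... | yes v≡N = 0 , ≤K⇒<N z≤n , played-dominates {v ∷ S} (here refl) (hat-dominates {v} v≡N (inj₁ refl))
  ... | no v≢N = toℕ v , <n⇒≢N⇒<N (toℕ<n v) v≢N , played-dominates {v ∷ S} (here refl) (inj₁ refl)

  -- … so while a cycle vertex is white there is a boundary, and Staller has a cheap move
  staller-cheap : ∀ {v S} → 1 ≤ Ψ (v ∷ S) → CheapMove (v ∷ S)
  staller-cheap {v} {S} Ψ≥1 with count-witness (white (v ∷ S)) 0 N Ψ≥1 | dominated-cycle-vertex v S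
  ... | j , (_ , j<N) , white-j | d , d<N , dom-d =
    cheap-move (v ∷ S) (boundary-exists (v ∷ S) d j d<N j<N dom-d white-j)

  available : ∀ {S} → 1 ≤ Ψ S → Σ V (Legal S)
  available {S} Ψ≥1 with count-witness (white S) 0 N Ψ≥1
  ... | j , (_ , j<N) , white-j =
    x , legal-at {S} {x} x (inj₁ refl) (white-vertex {S} (<N⇒<n j<N) white-j)
    where
    x : V
    x = vertex j (<N⇒<n j<N)

  open StallerPotential Ψ available Ψ-drop≤3 staller-cheap using (dominatorTurn)

  lower : MaxD (2 * k + 1) []
  lower = subst (λ m → MaxD m []) (two-k+1 k) (dominatorTurn k (≤-reflexive Ψ-initial))
    where
    Ψ-initial : suc (4 * k) ≡ Ψ []
    Ψ-initial = trans (trans (sym N≡1+K) (sym (*-identityʳ N)))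
                      (sym (sumRange-const (λ i → bit (white [] i)) 0 N 1 (λ _ _ → refl)))
    two-k+1 : ∀ k → suc (k + k) ≡ 2 * k + 1
    two-k+1 = solve-∀

proposition3p2 : (k : ℕ) → (k≥1 : 1 ≤ k) →
    Game.GameDominationNumberIs (hatC k k≥1) (2 * k + 1) × 2 * (2 * k + 1) ≡ n (hatC k k≥1)
proposition3p2 k k≥1 = (HattedCycle.upper k k≥1 , HattedCycle.lower k k≥1) , order k
  where
  order : ∀ k → 2 * (2 * k + 1) ≡ 4 * k + 2
  order = solve-∀
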